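{- Let $C$ be a chord diagram with $n$ chords. For any choice of a cut point on the circle of $C$ (a point distinct from all chord endpoints), let $\overrightarrow{g(C)}$ be the resulting oriented intersection graph and $A_{\overrightarrow{g(C)}}$ its antisymmetric adjacency matrix. Then the polynomial $\det(uI-A_{\overrightarrow{g(C)}})$ does not depend on the choice of the cut point.
   Context: A chord diagram of order $n$ is an oriented circle with a set of $n$ disjoint pairs of distinct points (chords), considered up to orientation-preserving diffeomorphisms of the circle. Its intersection graph $g(C)$ has the chords as vertices, two chords being adjacent iff their endpoints alternate along the circle. Given a cut point, cut the circle there to obtain an oriented line; number the chords $1,\dots,n$ in the order in which their first (leftmost) endpoints appear along this line, and orient each edge of $g(C)$ from the smaller-numbered vertex to the larger. The antisymmetric adjacency matrix of an oriented simple graph on vertices $1,\dots,n$ is $A=(a_{ij})$ with $a_{ij}=1$ if there is an edge oriented $i\to j$, $a_{ij}=-1$ if there is an edge oriented $j\to i$, and $a_{ij}=0$ otherwise. -}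

module Defs where

open import Data.Nat using (ℕ; zero; suc)
open import Data.Integer using (ℤ; 0ℤ; 1ℤ; -1ℤ) renaming (_+_ to _+ℤ_; _*_ to _*ℤ_; -_ to -ℤ_)
open import Data.Fin using (Fin; zero; suc; punchIn; _<_; _<?_)
open import Data.Fin.Properties using (_≟_)
open import Data.List using (List; []; _∷_; length; filter; deduplicate; drop; take; _++_; lookup)
open import Data.Sum using (_⊎_)
open import Relation.Nullary using (yes; no; _⊎-dec_)
open import Relation.Binary.PropositionalEquality using (_≡_)
import Data.List.Relation.Binary.Sublist.DecPropositional as SubDec

-- Polynomials in one variable u over ℤ, as coefficient lists
-- (constant coefficient first).  Equality of polynomials is equality
-- of all coefficients (so trailing zeros do not matter).

Poly : Set
Poly = List ℤ

coeff : Poly → ℕ → ℤ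
coeff []       _       = 0ℤ
coeff (a ∷ p)  zero    = a
coeff (a ∷ p)  (suc k) = coeff p k

_≈ᵖ_ : Poly → Poly → Set
p ≈ᵖ q = ∀ k → coeff p k ≡ coeff q k

infixl 6 _+ᵖ_
infixl 7 _*ᵖ_ _·ᵖ_

_+ᵖ_ : Poly → Poly → Poly
[]      +ᵖ q       = q
(a ∷ p) +ᵖ []      = a ∷ p
(a ∷ p) +ᵖ (b ∷ q) = (a +ℤ b) ∷ (p +ᵖ q)

_·ᵖ_ : ℤ → Poly → Poly
c ·ᵖ []      = []
c ·ᵖ (a ∷ p) = (c *ℤ a) ∷ (c ·ᵖ p)

_*ᵖ_ : Poly → Poly → Poly
[]      *ᵖ q = []
(a ∷ p) *ᵖ q = (a ·ᵖ q) +ᵖ (0ℤ ∷ (p *ᵖ q))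

-ᵖ_ : Poly → Poly
-ᵖ p = -1ℤ ·ᵖ p

const : ℤ → Poly
const c = c ∷ []

var : Poly
var = 0ℤ ∷ 1ℤ ∷ []

sumFin : ∀ m → (Fin m → Poly) → Poly
sumFin zero    f = []
sumFin (suc m) f = f zero +ᵖ sumFin m (λ i → f (suc i))

sign : ℕ → ℤ
sign zero          = 1ℤ
sign (suc zero)    = -1ℤ
sign (suc (suc j)) = sign j

det : ∀ m → (Fin m → Fin m → Poly) → Poly
det zero    M = const 1ℤ
det (suc m) M = sumFin (suc m) (λ j →
  sign (Data.Fin.toℕ j) ·ᵖ (M zero j *ᵖ det m (λ r c → M (suc r) (punchIn j c))))

charPoly : ∀ m → (Fin m → Fin m → ℤ) → Poly
charPoly m A = det m (λ i j → δ i j +ᵖ (-ᵖ const (A i j)))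
  where
  δ : Fin m → Fin m → Poly
  δ i j with i ≟ j
  ... | yes _ = var
  ... | no  _ = []

-- A chord diagram of order n, cut at some point, is read along the
-- resulting oriented line as a word w over the chord labels Fin n in
-- which every label occurs exactly twice (the two endpoints of that
-- chord).  The labels are arbitrary names (the diagram is considered up
-- to diffeomorphism); the canonical numbering is computed below.

occurrences : ∀ {n} → Fin n → List (Fin n) → ℕ
occurrences c w = length (filter (_≟ c) w)

IsChordWord : ∀ n → List (Fin n) → Set
IsChordWord n w = ∀ (c : Fin n) → occurrences c w ≡ 2

-- Moving the cut point: cutting the same circle at the point just
-- before the k-th endpoint (0-based) of the linear word w gives the
-- rotated word.  Every cut point of the circle arises this way for
-- some k < length w.
rotate : ∀ {n} → ℕ → List (Fin n) → List (Fin n)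
rotate k w = drop k w ++ take k w

-- The chords in the order of their first (leftmost) endpoints:
-- chord number i (0-based) is the label  lookup (chordOrder w) i .
chordOrder : ∀ {n} → List (Fin n) → List (Fin n)
chordOrder w = deduplicate _≟_ w

numChords : ∀ {n} → List (Fin n) → ℕ
numChords w = length (chordOrder w)

module _ {n : ℕ} where
  open SubDec {A = Fin n} _≟_ using (_⊆_; _⊆?_)

  Alternate : List (Fin n) → Fin n → Fin n → Set
  Alternate w c d = ((c ∷ d ∷ c ∷ d ∷ []) ⊆ w) ⊎ ((d ∷ c ∷ d ∷ c ∷ []) ⊆ w)

  -- antisymmetric adjacency matrix of the oriented intersection graph:
  -- vertices = chords numbered by first endpoints, edges oriented from
  -- smaller number to larger number.
  adjMatrix : (w : List (Fin n)) → Fin (numChords w) → Fin (numChords w) → ℤ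
  adjMatrix w i j with (c i ∷ c j ∷ c i ∷ c j ∷ []) ⊆? w ⊎-dec (c j ∷ c i ∷ c j ∷ c i ∷ []) ⊆? w
    where c = lookup (chordOrder w)
  ... | no _ = 0ℤ
  ... | yes _ with i <? j | j <? i
  ...   | yes _ | _     = 1ℤ
  ...   | no _  | yes _ = -1ℤ
  ...   | no _  | no _  = 0ℤ

orientedCharPoly : ∀ {n} → List (Fin n) → Poly
orientedCharPoly w = charPoly (numChords w) (adjMatrix w)

{-# OPTIONS --safe #-}
-- Moving the cut point across one endpoint turns the cut word x ∷ r into r ++ [ x ].  Chord x
-- moves from the first place of the chord order to the place of its second endpoint; the other
-- chords keep their relative order, and alternation of endpoints is unchanged.  A chord crossing
-- x has an endpoint between the two endpoints of x, so it now precedes x: exactly the edges at x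
-- reverse.  Hence the new matrix is P S A S Pᵀ with S = diag(-1, 1, …, 1) and P a permutation
-- matrix, and uI - A is conjugated in the same way, which does not change its determinant.
module Submission where

open import Defs
open import Data.Nat.Base as ℕ using (ℕ; zero; suc; z≤n; s≤s; _<_; _≤_)
import Data.Nat.Properties as ℕ
open import Data.Integer.Base using (ℤ; 0ℤ; 1ℤ; -1ℤ; _+_; _*_)
import Data.Integer.Properties as ℤ
open import Data.Integer.Tactic.RingSolver using (solve-∀)
open import Data.Fin.Base as Fin using (Fin; zero; suc; toℕ; punchIn; inject₁; cast)
import Data.Fin.Properties as Fin
open import Data.Fin.Properties using (_≟_; _<?_)
open import Data.Fin.Induction using (<-weakInduction)
open import Data.List.Base using (List; []; _∷_; _++_; [_]; length; lookup; filter; take; drop)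
open import Data.List.Properties
  using (filter-accept; filter-reject; filter-++; filter-all; length-++; length-++-sucʳ; ++-assoc; take++drop≡id; ∷ʳ-injective)
open import Data.List.Membership.Propositional using (_∈_; _∉_)
open import Data.List.Membership.Propositional.Properties
  using (∈-++⁺ʳ; ∈-++⁻; ∈-∃++; ∈-filter⁺; ∈-deduplicate⁺; ∈-lookup)
open import Data.List.Relation.Unary.Any using (here; there)
open import Data.List.Relation.Unary.All using ([]; _∷_)
import Data.List.Relation.Unary.All as All
open import Data.List.Relation.Unary.All.Properties using (¬Any⇒All¬)
open import Data.List.Relation.Unary.AllPairs using (_∷_)
open import Data.List.Relation.Unary.Unique.Propositional using (Unique)
open import Data.List.Relation.Unary.Unique.Propositional.Properties using (Unique[x∷xs]⇒x∉xs)
open import Data.List.Relation.Unary.Unique.DecPropositional.Properties using (deduplicate-!)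
open import Data.List.Relation.Binary.Sublist.Propositional using (_⊆_; []; _∷ʳ_; _∷_; ⊆-trans; to∈; from∈)
open import Data.List.Relation.Binary.Sublist.Propositional.Properties using (++⁺; ++⁺ʳ; ∷ˡ⁻; take-⊆; filter⁺)
import Data.List.Relation.Binary.Sublist.DecPropositional as DecSublist
open import Data.Product.Base using (Σ; ∃; ∃₂; _×_; _,_; proj₁; proj₂)
open import Data.Sum.Base using (_⊎_; inj₁; inj₂)
open import Data.Empty using (⊥-elim)
open import Function.Base using (_∘_)
open import Relation.Nullary using (¬_; Dec; yes; no; ¬?; _⊎-dec_)
open import Level using (0ℓ)
open import Relation.Unary using (Pred; Decidable)
open import Relation.Binary.Bundles using (Setoid)
open import Relation.Binary.Definitions using (tri<; tri≈; tri>)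
open import Relation.Binary.PropositionalEquality
  using (_≡_; _≢_; refl; sym; trans; cong; cong₂; subst; subst₂; module ≡-Reasoning)
import Relation.Binary.Reasoning.Setoid as SetoidReasoning

private variable
  m : ℕ
  p p′ q q′ : Poly

-- Polynomial arithmetic up to coefficientwise equality

coeff-+ᵖ : ∀ p q k → coeff (p +ᵖ q) k ≡ coeff p k + coeff q k
coeff-+ᵖ []      q       k       = sym (ℤ.+-identityˡ _)
coeff-+ᵖ (a ∷ p) []      k       = sym (ℤ.+-identityʳ _)
coeff-+ᵖ (a ∷ p) (b ∷ q) zero    = refl
coeff-+ᵖ (a ∷ p) (b ∷ q) (suc k) = coeff-+ᵖ p q k

coeff-·ᵖ : ∀ c p k → coeff (c ·ᵖ p) k ≡ c * coeff p k
coeff-·ᵖ c []      k       = sym (ℤ.*-zeroʳ c)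
coeff-·ᵖ c (a ∷ p) zero    = refl
coeff-·ᵖ c (a ∷ p) (suc k) = coeff-·ᵖ c p k

-- A record around the Π-type _≈ᵖ_, so that Agda can infer both polynomials.
infix 4 _≈_
record _≈_ (p q : Poly) : Set where
  constructor mk≈
  field coeffwise : p ≈ᵖ q
open _≈_

≈-refl : p ≈ p
≈-refl = mk≈ λ _ → refl

≈-reflexive : p ≡ q → p ≈ q
≈-reflexive refl = ≈-refl

≈-sym : p ≈ q → q ≈ p
≈-sym (mk≈ e) = mk≈ λ k → sym (e k)

≈-trans : ∀ {r} → p ≈ q → q ≈ r → p ≈ r
≈-trans (mk≈ e) (mk≈ f) = mk≈ λ k → trans (e k) (f k)

≈-setoid : Setoid _ _
≈-setoid = record
  { Carrier       = Poly
  ; _≈_           = _≈_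
  ; isEquivalence = record { refl = ≈-refl ; sym = ≈-sym ; trans = ≈-trans }
  }

module ≈-Reasoning = SetoidReasoning ≈-setoid

∷-cong : ∀ {a b} → a ≡ b → p ≈ q → a ∷ p ≈ b ∷ q
∷-cong e (mk≈ f) = mk≈ λ { zero → e ; (suc k) → f k }

+ᵖ-cong : p ≈ p′ → q ≈ q′ → p +ᵖ q ≈ p′ +ᵖ q′
+ᵖ-cong {p} {p′} {q} {q′} (mk≈ e) (mk≈ f) = mk≈ λ k → begin
  coeff (p +ᵖ q) k         ≡⟨ coeff-+ᵖ p q k ⟩
  coeff p k + coeff q k    ≡⟨ cong₂ _+_ (e k) (f k) ⟩
  coeff p′ k + coeff q′ k  ≡⟨ coeff-+ᵖ p′ q′ k ⟨
  coeff (p′ +ᵖ q′) k       ∎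
  where open ≡-Reasoning

·ᵖ-congʳ : ∀ c → p ≈ q → c ·ᵖ p ≈ c ·ᵖ q
·ᵖ-congʳ {p} {q} c (mk≈ e) = mk≈ λ k →
  trans (coeff-·ᵖ c p k) (trans (cong (c *_) (e k)) (sym (coeff-·ᵖ c q k)))

+ᵖ-comm : ∀ p q → p +ᵖ q ≈ q +ᵖ p
+ᵖ-comm p q = mk≈ λ k →
  trans (coeff-+ᵖ p q k) (trans (ℤ.+-comm (coeff p k) (coeff q k)) (sym (coeff-+ᵖ q p k)))

+ᵖ-assoc : ∀ p q r → (p +ᵖ q) +ᵖ r ≈ p +ᵖ (q +ᵖ r)
+ᵖ-assoc p q r = mk≈ coeffwise-assoc
  where
  coeffwise-assoc : ((p +ᵖ q) +ᵖ r) ≈ᵖ (p +ᵖ (q +ᵖ r))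
  coeffwise-assoc k
    rewrite coeff-+ᵖ (p +ᵖ q) r k | coeff-+ᵖ p q k | coeff-+ᵖ p (q +ᵖ r) k | coeff-+ᵖ q r k
    = ℤ.+-assoc (coeff p k) (coeff q k) (coeff r k)

+ᵖ-identityʳ : ∀ p → p +ᵖ [] ≈ p
+ᵖ-identityʳ p = mk≈ λ k → trans (coeff-+ᵖ p [] k) (ℤ.+-identityʳ _)

+ᵖ-interchange : ∀ p q p′ q′ → (p +ᵖ q) +ᵖ (p′ +ᵖ q′) ≈ (p +ᵖ p′) +ᵖ (q +ᵖ q′)
+ᵖ-interchange p q p′ q′ = mk≈ coeffwise-interchange
  where
  interchange : ∀ x y z w → (x + y) + (z + w) ≡ (x + z) + (y + w)
  interchange = solve-∀

  coeffwise-interchange : ((p +ᵖ q) +ᵖ (p′ +ᵖ q′)) ≈ᵖ ((p +ᵖ p′) +ᵖ (q +ᵖ q′))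
  coeffwise-interchange k
    rewrite coeff-+ᵖ (p +ᵖ q) (p′ +ᵖ q′) k | coeff-+ᵖ (p +ᵖ p′) (q +ᵖ q′) k
          | coeff-+ᵖ p q k | coeff-+ᵖ p′ q′ k | coeff-+ᵖ p p′ k | coeff-+ᵖ q q′ k
    = interchange (coeff p k) (coeff q k) (coeff p′ k) (coeff q′ k)

+ᵖ-lcomm : ∀ p q r → p +ᵖ (q +ᵖ r) ≈ q +ᵖ (p +ᵖ r)
+ᵖ-lcomm p q r = ≈-trans (≈-sym (+ᵖ-assoc p q r))
  (≈-trans (+ᵖ-cong (+ᵖ-comm p q) (≈-refl {r})) (+ᵖ-assoc q p r))

·ᵖ-distribˡ : ∀ c p q → c ·ᵖ (p +ᵖ q) ≈ c ·ᵖ p +ᵖ c ·ᵖ q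
·ᵖ-distribˡ c p q = mk≈ coeffwise-distrib
  where
  coeffwise-distrib : (c ·ᵖ (p +ᵖ q)) ≈ᵖ (c ·ᵖ p +ᵖ c ·ᵖ q)
  coeffwise-distrib k
    rewrite coeff-·ᵖ c (p +ᵖ q) k | coeff-+ᵖ (c ·ᵖ p) (c ·ᵖ q) k
          | coeff-+ᵖ p q k | coeff-·ᵖ c p k | coeff-·ᵖ c q k
    = ℤ.*-distribˡ-+ c _ _

·ᵖ-distribʳ : ∀ a b p → (a + b) ·ᵖ p ≈ a ·ᵖ p +ᵖ b ·ᵖ p
·ᵖ-distribʳ a b p = mk≈ coeffwise-distrib
  where
  coeffwise-distrib : ((a + b) ·ᵖ p) ≈ᵖ (a ·ᵖ p +ᵖ b ·ᵖ p)
  coeffwise-distrib k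
    rewrite coeff-·ᵖ (a + b) p k | coeff-+ᵖ (a ·ᵖ p) (b ·ᵖ p) k | coeff-·ᵖ a p k | coeff-·ᵖ b p k
    = ℤ.*-distribʳ-+ _ a b

·ᵖ-assoc : ∀ a b p → a ·ᵖ (b ·ᵖ p) ≈ (a * b) ·ᵖ p
·ᵖ-assoc a b p = mk≈ λ k → begin
  coeff (a ·ᵖ (b ·ᵖ p)) k  ≡⟨ coeff-·ᵖ a (b ·ᵖ p) k ⟩
  a * coeff (b ·ᵖ p) k     ≡⟨ cong (a *_) (coeff-·ᵖ b p k) ⟩
  a * (b * coeff p k)      ≡⟨ ℤ.*-assoc a b _ ⟨
  (a * b) * coeff p k      ≡⟨ coeff-·ᵖ (a * b) p k ⟨
  coeff ((a * b) ·ᵖ p) k   ∎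
  where open ≡-Reasoning

·ᵖ-identity : ∀ p → 1ℤ ·ᵖ p ≈ p
·ᵖ-identity p = mk≈ λ k → trans (coeff-·ᵖ 1ℤ p k) (ℤ.*-identityˡ _)

·ᵖ-zero : ∀ p → 0ℤ ·ᵖ p ≈ []
·ᵖ-zero p = mk≈ (coeff-·ᵖ 0ℤ p)

-1·ᵖ-involutive : ∀ p → -1ℤ ·ᵖ (-1ℤ ·ᵖ p) ≈ p
-1·ᵖ-involutive p = ≈-trans (·ᵖ-assoc -1ℤ -1ℤ p) (·ᵖ-identity p)

·ᵖ-comm : ∀ a b p → a ·ᵖ (b ·ᵖ p) ≈ b ·ᵖ (a ·ᵖ p)
·ᵖ-comm a b p = ≈-trans (·ᵖ-assoc a b p)
  (≈-trans (≈-reflexive (cong (_·ᵖ p) (ℤ.*-comm a b))) (≈-sym (·ᵖ-assoc b a p)))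

*ᵖ-zeroʳ : ∀ p → p *ᵖ [] ≈ []
*ᵖ-zeroʳ []      = ≈-refl
*ᵖ-zeroʳ (a ∷ p) = mk≈ λ { zero → refl ; (suc k) → coeffwise (*ᵖ-zeroʳ p) k }

*ᵖ-consʳ : ∀ p b q → p *ᵖ (b ∷ q) ≈ b ·ᵖ p +ᵖ (0ℤ ∷ p *ᵖ q)
*ᵖ-consʳ []      b q = mk≈ λ { zero → refl ; (suc k) → refl }
*ᵖ-consʳ (a ∷ p) b q = ∷-cong (swapHead a b) (begin
  a ·ᵖ q +ᵖ p *ᵖ (b ∷ q)                 ≈⟨ +ᵖ-cong (≈-refl {a ·ᵖ q}) (*ᵖ-consʳ p b q) ⟩
  a ·ᵖ q +ᵖ (b ·ᵖ p +ᵖ (0ℤ ∷ p *ᵖ q))    ≈⟨ +ᵖ-lcomm (a ·ᵖ q) (b ·ᵖ p) _ ⟩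
  b ·ᵖ p +ᵖ (a ·ᵖ q +ᵖ (0ℤ ∷ p *ᵖ q))    ∎)
  where
  open ≈-Reasoning
  swapHead : ∀ x y → x * y + 0ℤ ≡ y * x + 0ℤ
  swapHead = solve-∀

*ᵖ-comm : ∀ p q → p *ᵖ q ≈ q *ᵖ p
*ᵖ-comm []      q = ≈-sym (*ᵖ-zeroʳ q)
*ᵖ-comm (a ∷ p) q =
  ≈-trans (+ᵖ-cong (≈-refl {a ·ᵖ q}) (∷-cong refl (*ᵖ-comm p q))) (≈-sym (*ᵖ-consʳ q a p))

*ᵖ-congʳ : ∀ p → q ≈ q′ → p *ᵖ q ≈ p *ᵖ q′
*ᵖ-congʳ []      e = ≈-refl
*ᵖ-congʳ (a ∷ p) e = +ᵖ-cong (·ᵖ-congʳ a e) (∷-cong refl (*ᵖ-congʳ p e))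

*ᵖ-cong : p ≈ p′ → q ≈ q′ → p *ᵖ q ≈ p′ *ᵖ q′
*ᵖ-cong {p} {p′} {q} {q′} e f =
  ≈-trans (*ᵖ-comm p q) (≈-trans (*ᵖ-congʳ q e) (≈-trans (*ᵖ-comm q p′) (*ᵖ-congʳ p′ f)))

*ᵖ-·ᵖ-assocˡ : ∀ c p q → (c ·ᵖ p) *ᵖ q ≈ c ·ᵖ (p *ᵖ q)
*ᵖ-·ᵖ-assocˡ c []      q = ≈-refl
*ᵖ-·ᵖ-assocˡ c (a ∷ p) q = ≈-trans
  (+ᵖ-cong (≈-sym (·ᵖ-assoc c a q)) (∷-cong (sym (ℤ.*-zeroʳ c)) (*ᵖ-·ᵖ-assocˡ c p q)))
  (≈-sym (·ᵖ-distribˡ c (a ·ᵖ q) (0ℤ ∷ p *ᵖ q)))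

*ᵖ-·ᵖ-assocʳ : ∀ c p q → p *ᵖ (c ·ᵖ q) ≈ c ·ᵖ (p *ᵖ q)
*ᵖ-·ᵖ-assocʳ c p q =
  ≈-trans (*ᵖ-comm p (c ·ᵖ q)) (≈-trans (*ᵖ-·ᵖ-assocˡ c q p) (·ᵖ-congʳ c (*ᵖ-comm q p)))

*ᵖ-distribʳ : ∀ p q r → (p +ᵖ q) *ᵖ r ≈ p *ᵖ r +ᵖ q *ᵖ r
*ᵖ-distribʳ []      q       r = ≈-refl
*ᵖ-distribʳ (a ∷ p) []      r = ≈-sym (+ᵖ-identityʳ _)
*ᵖ-distribʳ (a ∷ p) (b ∷ q) r = ≈-trans
  (+ᵖ-cong (·ᵖ-distribʳ a b r) (∷-cong (sym (ℤ.+-identityʳ 0ℤ)) (*ᵖ-distribʳ p q r)))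
  (+ᵖ-interchange (a ·ᵖ r) (b ·ᵖ r) (0ℤ ∷ p *ᵖ r) (0ℤ ∷ q *ᵖ r))

*ᵖ-distribˡ : ∀ p q r → p *ᵖ (q +ᵖ r) ≈ p *ᵖ q +ᵖ p *ᵖ r
*ᵖ-distribˡ p q r = ≈-trans (*ᵖ-comm p (q +ᵖ r))
  (≈-trans (*ᵖ-distribʳ q r p) (+ᵖ-cong (*ᵖ-comm q p) (*ᵖ-comm r p)))

*ᵖ-assoc : ∀ p q r → (p *ᵖ q) *ᵖ r ≈ p *ᵖ (q *ᵖ r)
*ᵖ-assoc []      q r = ≈-refl
*ᵖ-assoc (a ∷ p) q r = ≈-trans (*ᵖ-distribʳ (a ·ᵖ q) (0ℤ ∷ p *ᵖ q) r)
  (+ᵖ-cong (*ᵖ-·ᵖ-assocˡ a q r)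
           (≈-trans (+ᵖ-cong (·ᵖ-zero r) ≈-refl) (∷-cong refl (*ᵖ-assoc p q r))))

sumFin-cong : ∀ m {f g : Fin m → Poly} → (∀ i → f i ≈ g i) → sumFin m f ≈ sumFin m g
sumFin-cong zero    e = ≈-refl
sumFin-cong (suc m) e = +ᵖ-cong (e zero) (sumFin-cong m (e ∘ suc))

sumFin-+ᵖ : ∀ m (f g : Fin m → Poly) → sumFin m (λ i → f i +ᵖ g i) ≈ sumFin m f +ᵖ sumFin m g
sumFin-+ᵖ zero    f g = ≈-refl
sumFin-+ᵖ (suc m) f g = ≈-trans
  (+ᵖ-cong (≈-refl {f zero +ᵖ g zero}) (sumFin-+ᵖ m (f ∘ suc) (g ∘ suc)))
  (+ᵖ-interchange (f zero) (g zero) (sumFin m (f ∘ suc)) (sumFin m (g ∘ suc)))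

sumFin-·ᵖ : ∀ m c (f : Fin m → Poly) → sumFin m (λ i → c ·ᵖ f i) ≈ c ·ᵖ sumFin m f
sumFin-·ᵖ zero    c f = ≈-refl
sumFin-·ᵖ (suc m) c f = ≈-trans (+ᵖ-cong (≈-refl {c ·ᵖ f zero}) (sumFin-·ᵖ m c (f ∘ suc)))
  (≈-sym (·ᵖ-distribˡ c (f zero) _))

sumFin-*ᵖ : ∀ m p (f : Fin m → Poly) → sumFin m (λ i → p *ᵖ f i) ≈ p *ᵖ sumFin m f
sumFin-*ᵖ zero    p f = ≈-sym (*ᵖ-zeroʳ p)
sumFin-*ᵖ (suc m) p f = ≈-trans (+ᵖ-cong (≈-refl {p *ᵖ f zero}) (sumFin-*ᵖ m p (f ∘ suc)))
  (≈-sym (*ᵖ-distribˡ p (f zero) _))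

sumFin-zero : ∀ m → sumFin m (λ _ → []) ≈ []
sumFin-zero zero    = ≈-refl
sumFin-zero (suc m) = sumFin-zero m

sumFin-swap : ∀ m k (f : Fin m → Fin k → Poly) →
  sumFin m (λ i → sumFin k (f i)) ≈ sumFin k (λ j → sumFin m (λ i → f i j))
sumFin-swap zero    k f = ≈-sym (sumFin-zero k)
sumFin-swap (suc m) k f = ≈-trans
  (+ᵖ-cong (≈-refl {sumFin k (f zero)}) (sumFin-swap m k (f ∘ suc)))
  (≈-sym (sumFin-+ᵖ k (f zero) (λ j → sumFin m (λ i → f (suc i) j))))

sumFin-negate : ∀ m {f g : Fin m → Poly} → (∀ i → f i ≈ -1ℤ ·ᵖ g i) → sumFin m f ≈ -1ℤ ·ᵖ sumFin m g
sumFin-negate m {g = g} e = ≈-trans (sumFin-cong m e) (sumFin-·ᵖ m -1ℤ g)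

sign-suc : ∀ k → sign (suc k) ≡ -1ℤ * sign k
sign-suc zero    = refl
sign-suc (suc k) = trans (sym (-1*-1* (sign k))) (cong (-1ℤ *_) (sym (sign-suc k)))
  where
  -1*-1* : ∀ x → -1ℤ * (-1ℤ * x) ≡ x
  -1*-1* = solve-∀

sign-suc-swap : ∀ k l → sign (suc k) * sign l ≡ sign (suc l) * sign k
sign-suc-swap k l rewrite sign-suc k | sign-suc l = swap (sign k) (sign l)
  where
  swap : ∀ x y → (-1ℤ * x) * y ≡ (-1ℤ * y) * x
  swap = solve-∀

Mat : ℕ → Set
Mat m = Fin m → Fin m → Poly

_ᵀ : Mat m → Mat m
(M ᵀ) i j = M j i

minor : Fin (suc m) → Mat (suc m) → Mat m
minor j M r c = M (suc r) (punchIn j c)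

columnMinor : Fin (suc m) → Mat (suc m) → Mat m
columnMinor i M r c = M (punchIn i r) (suc c)

det-cong : ∀ m {M N : Mat m} → (∀ i j → M i j ≈ N i j) → det m M ≈ det m N
det-cong zero    e = ≈-refl
det-cong (suc m) e = sumFin-cong (suc m) λ j →
  ·ᵖ-congʳ (sign (toℕ j)) (*ᵖ-cong (e zero j) (det-cong m (λ r c → e (suc r) (punchIn j c))))

det-cong-≡ : ∀ m {M N : Mat m} → (∀ i j → M i j ≡ N i j) → det m M ≈ det m N
det-cong-≡ m e = det-cong m (λ i j → ≈-reflexive (e i j))

·ᵖ-*ᵖ-negate : ∀ s p q → s ·ᵖ (p *ᵖ (-1ℤ ·ᵖ q)) ≈ -1ℤ ·ᵖ (s ·ᵖ (p *ᵖ q))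
·ᵖ-*ᵖ-negate s p q = ≈-trans (·ᵖ-congʳ s (*ᵖ-·ᵖ-assocʳ -1ℤ p q)) (·ᵖ-comm s -1ℤ _)

term-negate : ∀ s p {d d′} → d′ ≈ -1ℤ ·ᵖ d → s ·ᵖ (p *ᵖ d′) ≈ -1ℤ ·ᵖ (s ·ᵖ (p *ᵖ d))
term-negate s p e = ≈-trans (·ᵖ-congʳ s (*ᵖ-congʳ p e)) (·ᵖ-*ᵖ-negate s p _)

columnExpansion : ∀ m → Mat (suc m) → Poly
columnExpansion m M = sumFin (suc m) λ i → sign (toℕ i) ·ᵖ (M i zero *ᵖ det m (columnMinor i M))

det≈columnExpansion : (∀ X → det (suc m) (X ᵀ) ≈ det (suc m) X) → (∀ X → det m (X ᵀ) ≈ det m X) →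
  ∀ X → det (suc m) X ≈ columnExpansion m X
det≈columnExpansion {m} det-ᵀ₁ det-ᵀ₀ X = ≈-trans (≈-sym (det-ᵀ₁ X)) (sumFin-cong (suc m) λ i →
  ·ᵖ-congʳ (sign (toℕ i)) (*ᵖ-congʳ (X i zero) (det-ᵀ₀ (columnMinor i X))))

scaled-columnExpansion : (∀ X → det (suc m) X ≈ columnExpansion m X) → ∀ s p X →
  s ·ᵖ (p *ᵖ det (suc m) X) ≈
  sumFin (suc m) (λ i → (s * sign (toℕ i)) ·ᵖ ((p *ᵖ X i zero) *ᵖ det m (columnMinor i X)))
scaled-columnExpansion {m} expand s p X = begin
  s ·ᵖ (p *ᵖ det (suc m) X)                        ≈⟨ ·ᵖ-congʳ s (*ᵖ-congʳ p (expand X)) ⟩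
  s ·ᵖ (p *ᵖ sumFin (suc m) term)                   ≈⟨ ·ᵖ-congʳ s (sumFin-*ᵖ (suc m) p term) ⟨
  s ·ᵖ sumFin (suc m) (λ i → p *ᵖ term i)           ≈⟨ sumFin-·ᵖ (suc m) s (λ i → p *ᵖ term i) ⟨
  sumFin (suc m) (λ i → s ·ᵖ (p *ᵖ term i))         ≈⟨ sumFin-cong (suc m) rearrange ⟩
  sumFin (suc m) (λ i → (s * sign (toℕ i)) ·ᵖ ((p *ᵖ X i zero) *ᵖ det m (columnMinor i X))) ∎
  where
  open ≈-Reasoning
  term : Fin (suc m) → Poly
  term i = sign (toℕ i) ·ᵖ (X i zero *ᵖ det m (columnMinor i X))
  rearrange : ∀ i → s ·ᵖ (p *ᵖ term i) ≈ (s * sign (toℕ i)) ·ᵖ ((p *ᵖ X i zero) *ᵖ det m (columnMinor i X))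
  rearrange i = ≈-trans (·ᵖ-congʳ s (*ᵖ-·ᵖ-assocʳ (sign (toℕ i)) p _))
    (≈-trans (·ᵖ-assoc s (sign (toℕ i)) _) (·ᵖ-congʳ (s * sign (toℕ i)) (≈-sym (*ᵖ-assoc p _ _))))

-- Expanding det (M ᵀ) and det M along their first rows, and every minor along its first
-- column, gives the same double sum up to exchanging the order of summation.
det-ᵀ-step : ∀ m → (∀ X → det (suc m) (X ᵀ) ≈ det (suc m) X) → (∀ X → det m (X ᵀ) ≈ det m X) →
  ∀ M → det (suc (suc m)) (M ᵀ) ≈ det (suc (suc m)) M
det-ᵀ-step m det-ᵀ₁ det-ᵀ₀ M =
  +ᵖ-cong (·ᵖ-congʳ 1ℤ (*ᵖ-congʳ (M zero zero) (det-ᵀ₁ (minor zero M)))) (begin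
    sumFin (suc m) (λ i → sign (suc (toℕ i)) ·ᵖ (M (suc i) zero *ᵖ det (suc m) (minor (suc i) (M ᵀ))))
      ≈⟨ sumFin-cong (suc m) (λ i → expand (sign (suc (toℕ i))) (M (suc i) zero) (minor (suc i) (M ᵀ))) ⟩
    sumFin (suc m) (λ i → sumFin (suc m) (λ j → termᵀ i j))
      ≈⟨ sumFin-cong (suc m) (λ i → sumFin-cong (suc m) (termᵀ≈term i)) ⟩
    sumFin (suc m) (λ i → sumFin (suc m) (λ j → term i j))
      ≈⟨ sumFin-swap (suc m) (suc m) term ⟩
    sumFin (suc m) (λ j → sumFin (suc m) (λ i → term i j))
      ≈⟨ sumFin-cong (suc m) (λ j → expand (sign (suc (toℕ j))) (M zero (suc j)) (minor (suc j) M)) ⟨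
    sumFin (suc m) (λ j → sign (suc (toℕ j)) ·ᵖ (M zero (suc j) *ᵖ det (suc m) (minor (suc j) M))) ∎)
  where
  open ≈-Reasoning
  expand : ∀ s p X → s ·ᵖ (p *ᵖ det (suc m) X) ≈
    sumFin (suc m) (λ i → (s * sign (toℕ i)) ·ᵖ ((p *ᵖ X i zero) *ᵖ det m (columnMinor i X)))
  expand = scaled-columnExpansion (det≈columnExpansion det-ᵀ₁ det-ᵀ₀)

  productᵀ termᵀ term : Fin (suc m) → Fin (suc m) → Poly
  productᵀ i j = (M (suc i) zero *ᵖ M zero (suc j)) *ᵖ det m (λ r c → M (suc (punchIn i c)) (suc (punchIn j r)))
  termᵀ i j = (sign (suc (toℕ i)) * sign (toℕ j)) ·ᵖ productᵀ i j
  term i j = (sign (suc (toℕ j)) * sign (toℕ i)) ·ᵖ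
    ((M zero (suc j) *ᵖ M (suc i) zero) *ᵖ det m (λ r c → M (suc (punchIn i r)) (suc (punchIn j c))))

  termᵀ≈term : ∀ i j → termᵀ i j ≈ term i j
  termᵀ≈term i j = ≈-trans (≈-reflexive (cong (_·ᵖ productᵀ i j) (sign-suc-swap (toℕ i) (toℕ j))))
    (·ᵖ-congʳ (sign (suc (toℕ j)) * sign (toℕ i)) (*ᵖ-cong (*ᵖ-comm (M (suc i) zero) (M zero (suc j)))
                         (det-ᵀ₀ (λ r c → M (suc (punchIn i r)) (suc (punchIn j c))))))

det-ᵀ : ∀ m (M : Mat m) → det m (M ᵀ) ≈ det m M
det-ᵀ zero          M = ≈-refl
det-ᵀ (suc zero)    M = ≈-refl
det-ᵀ (suc (suc m)) M = det-ᵀ-step m (det-ᵀ (suc m)) (det-ᵀ m) M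

-- Simultaneous row and column operations

adjSwap : Fin m → Fin (suc m) → Fin (suc m)
adjSwap zero    zero          = suc zero
adjSwap zero    (suc zero)    = zero
adjSwap zero    (suc (suc x)) = suc (suc x)
adjSwap (suc i) zero          = zero
adjSwap (suc i) (suc x)       = suc (adjSwap i x)

adjSwap₀-punchIn₀ : (c : Fin (suc m)) → adjSwap zero (punchIn zero c) ≡ punchIn (suc zero) c
adjSwap₀-punchIn₀ zero    = refl
adjSwap₀-punchIn₀ (suc c) = refl

adjSwap₀-punchIn₁ : (c : Fin (suc m)) → adjSwap zero (punchIn (suc zero) c) ≡ punchIn zero c
adjSwap₀-punchIn₁ zero    = refl
adjSwap₀-punchIn₁ (suc c) = refl

adjSwap₀-punchIn₂₊ : ∀ (i : Fin (suc m)) c → adjSwap zero (punchIn (suc (suc i)) c) ≡ punchIn (suc (suc i)) (adjSwap zero c)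
adjSwap₀-punchIn₂₊ i zero          = refl
adjSwap₀-punchIn₂₊ i (suc zero)    = refl
adjSwap₀-punchIn₂₊ i (suc (suc c)) = refl

swap-two-terms : ∀ {t₀ t₁ s t₀′ t₁′ s′} → t₀′ ≈ -1ℤ ·ᵖ t₁ → t₁′ ≈ -1ℤ ·ᵖ t₀ → s′ ≈ -1ℤ ·ᵖ s →
  t₀′ +ᵖ (t₁′ +ᵖ s′) ≈ -1ℤ ·ᵖ (t₀ +ᵖ (t₁ +ᵖ s))
swap-two-terms {t₀} {t₁} {s} e₀ e₁ e = begin
  _ ≈⟨ +ᵖ-cong e₀ (+ᵖ-cong e₁ e) ⟩
  -1ℤ ·ᵖ t₁ +ᵖ (-1ℤ ·ᵖ t₀ +ᵖ -1ℤ ·ᵖ s)  ≈⟨ +ᵖ-lcomm (-1ℤ ·ᵖ t₁) (-1ℤ ·ᵖ t₀) (-1ℤ ·ᵖ s) ⟩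
  -1ℤ ·ᵖ t₀ +ᵖ (-1ℤ ·ᵖ t₁ +ᵖ -1ℤ ·ᵖ s)  ≈⟨ +ᵖ-cong (≈-refl { -1ℤ ·ᵖ t₀}) (·ᵖ-distribˡ -1ℤ t₁ s) ⟨
  -1ℤ ·ᵖ t₀ +ᵖ -1ℤ ·ᵖ (t₁ +ᵖ s)         ≈⟨ ·ᵖ-distribˡ -1ℤ t₀ (t₁ +ᵖ s) ⟨
  -1ℤ ·ᵖ (t₀ +ᵖ (t₁ +ᵖ s))              ∎
  where open ≈-Reasoning

det-swapColumns₀₁ : ∀ m (M : Mat (suc (suc m))) →
  det (suc (suc m)) (λ r c → M r (adjSwap zero c)) ≈ -1ℤ ·ᵖ det (suc (suc m)) M
det-swapColumns₀₁ m M = swap-two-terms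
  (≈-trans (·ᵖ-identity _)
    (≈-trans (*ᵖ-congʳ (M zero (suc zero)) (det-cong-≡ (suc m) λ r c → cong (M (suc r)) (adjSwap₀-punchIn₀ c)))
             (≈-sym (-1·ᵖ-involutive _))))
  (·ᵖ-congʳ -1ℤ (≈-trans (*ᵖ-congʳ (M zero zero) (det-cong-≡ (suc m) λ r c → cong (M (suc r)) (adjSwap₀-punchIn₁ c)))
                         (≈-sym (·ᵖ-identity _))))
  (laterColumns m M)
  where
  laterColumns : ∀ m (M : Mat (suc (suc m))) →
    sumFin m (λ i → sign (toℕ i) ·ᵖ (M zero (suc (suc i)) *ᵖ det (suc m) (minor (suc (suc i)) (λ r c → M r (adjSwap zero c)))))
    ≈ -1ℤ ·ᵖ sumFin m (λ i → sign (toℕ i) ·ᵖ (M zero (suc (suc i)) *ᵖ det (suc m) (minor (suc (suc i)) M)))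
  laterColumns zero    M = ≈-refl
  laterColumns (suc m) M = sumFin-negate (suc m) λ i → term-negate (sign (toℕ i)) (M zero (suc (suc i)))
    (≈-trans (det-cong-≡ (suc (suc m)) λ r c → cong (M (suc r)) (adjSwap₀-punchIn₂₊ i c))
             (det-swapColumns₀₁ m (minor (suc (suc i)) M)))

det-adjSwap-rows : ∀ (i : Fin m) (M : Mat (suc m)) → det (suc m) (λ r c → M (adjSwap i r) c) ≈ -1ℤ ·ᵖ det (suc m) M
det-adjSwap-rows {suc m} zero M = begin
  det (suc (suc m)) (λ r c → M (adjSwap zero r) c)          ≈⟨ det-ᵀ (suc (suc m)) (λ r c → M (adjSwap zero r) c) ⟨
  det (suc (suc m)) (λ r c → (M ᵀ) r (adjSwap zero c))      ≈⟨ det-swapColumns₀₁ m (M ᵀ) ⟩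
  -1ℤ ·ᵖ det (suc (suc m)) (M ᵀ)                            ≈⟨ ·ᵖ-congʳ -1ℤ (det-ᵀ (suc (suc m)) M) ⟩
  -1ℤ ·ᵖ det (suc (suc m)) M                                ∎
  where open ≈-Reasoning
det-adjSwap-rows (suc i) M = sumFin-negate _ λ j →
  term-negate (sign (toℕ j)) (M zero j) (det-adjSwap-rows i (minor j M))

det-adjSwap-columns : ∀ (i : Fin m) (M : Mat (suc m)) → det (suc m) (λ r c → M r (adjSwap i c)) ≈ -1ℤ ·ᵖ det (suc m) M
det-adjSwap-columns {m} i M = ≈-trans (≈-sym (det-ᵀ (suc m) (λ r c → M r (adjSwap i c))))
  (≈-trans (det-adjSwap-rows i (M ᵀ)) (·ᵖ-congʳ -1ℤ (det-ᵀ (suc m) M)))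

det-conj-adjSwap : ∀ (i : Fin m) (M : Mat (suc m)) → det (suc m) (λ r c → M (adjSwap i r) (adjSwap i c)) ≈ det (suc m) M
det-conj-adjSwap i M = ≈-trans (det-adjSwap-rows i (λ r c → M r (adjSwap i c)))
  (≈-trans (·ᵖ-congʳ -1ℤ (det-adjSwap-columns i M)) (-1·ᵖ-involutive _))

moveZeroTo : Fin (suc m) → Fin (suc m) → Fin (suc m)
moveZeroTo q zero    = q
moveZeroTo q (suc i) = punchIn q i

moveZeroTo-zero : (i : Fin (suc m)) → moveZeroTo zero i ≡ i
moveZeroTo-zero zero    = refl
moveZeroTo-zero (suc i) = refl

moveZeroTo-suc : (t : Fin m) (i : Fin (suc m)) → moveZeroTo (suc t) i ≡ adjSwap t (moveZeroTo (inject₁ t) i)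
moveZeroTo-suc t zero    = sym (adjSwap-inject₁ t)
  where
  adjSwap-inject₁ : (t : Fin m) → adjSwap t (inject₁ t) ≡ suc t
  adjSwap-inject₁ zero    = refl
  adjSwap-inject₁ (suc t) = cong suc (adjSwap-inject₁ t)
moveZeroTo-suc t (suc i) = punchIn-suc t i
  where
  punchIn-suc : (t : Fin m) (i : Fin m) → punchIn (suc t) i ≡ adjSwap t (punchIn (inject₁ t) i)
  punchIn-suc zero    zero    = refl
  punchIn-suc zero    (suc i) = refl
  punchIn-suc (suc t) zero    = refl
  punchIn-suc (suc t) (suc i) = cong suc (punchIn-suc t i)

moveZeroTo-injective : ∀ (q : Fin (suc m)) {i j} → moveZeroTo q i ≡ moveZeroTo q j → i ≡ j
moveZeroTo-injective q {zero}  {zero}  e = refl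
moveZeroTo-injective q {zero}  {suc j} e = ⊥-elim (Fin.punchInᵢ≢i q j (sym e))
moveZeroTo-injective q {suc i} {zero}  e = ⊥-elim (Fin.punchInᵢ≢i q i e)
moveZeroTo-injective q {suc i} {suc j} e = cong suc (Fin.punchIn-injective q i j e)

-- moveZeroTo (suc t) is moveZeroTo (inject₁ t) followed by the swap of t and t + 1.
det-conj-moveZeroTo : ∀ (q : Fin (suc m)) (M : Mat (suc m)) →
  det (suc m) (λ i j → M (moveZeroTo q i) (moveZeroTo q j)) ≈ det (suc m) M
det-conj-moveZeroTo {m} = <-weakInduction Invariant base step
  where
  Invariant : Fin (suc m) → Set
  Invariant q = ∀ M → det (suc m) (λ i j → M (moveZeroTo q i) (moveZeroTo q j)) ≈ det (suc m) M

  base : Invariant zero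
  base M = det-cong-≡ (suc m) λ i j → cong₂ M (moveZeroTo-zero i) (moveZeroTo-zero j)

  step : ∀ t → Invariant (inject₁ t) → Invariant (suc t)
  step t ih M = ≈-trans (det-cong-≡ (suc m) λ i j → cong₂ M (moveZeroTo-suc t i) (moveZeroTo-suc t j))
    (≈-trans (ih (λ a b → M (adjSwap t a) (adjSwap t b))) (det-conj-adjSwap t M))

signAt₀ : Fin m → ℤ
signAt₀ zero    = -1ℤ
signAt₀ (suc _) = 1ℤ

signAt₀-punchIn : (j c : Fin m) → signAt₀ (punchIn (suc j) c) ≡ signAt₀ c
signAt₀-punchIn j zero    = refl
signAt₀-punchIn j (suc c) = refl

signAt₀-squared : (i : Fin m) → signAt₀ i * signAt₀ i ≡ 1ℤ
signAt₀-squared zero    = refl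
signAt₀-squared (suc i) = refl

term-negateEntry : ∀ s p {d d′} → d′ ≈ d → s ·ᵖ ((-1ℤ ·ᵖ p) *ᵖ d′) ≈ -1ℤ ·ᵖ (s ·ᵖ (p *ᵖ d))
term-negateEntry s p {d} e = ≈-trans
  (·ᵖ-congʳ s (≈-trans (*ᵖ-congʳ (-1ℤ ·ᵖ p) e) (*ᵖ-·ᵖ-assocˡ -1ℤ p d)))
  (·ᵖ-comm s -1ℤ (p *ᵖ d))

det-negateColumn₀ : ∀ m (M : Mat (suc m)) → det (suc m) (λ r c → signAt₀ c ·ᵖ M r c) ≈ -1ℤ ·ᵖ det (suc m) M
det-negateColumn₀ m M = ≈-trans
  (+ᵖ-cong (term-negateEntry 1ℤ (M zero zero) (det-cong m λ r c → ·ᵖ-identity (M (suc r) (suc c))))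
           (sumFin-negate m (laterColumns m M)))
  (≈-sym (·ᵖ-distribˡ -1ℤ (1ℤ ·ᵖ (M zero zero *ᵖ det m (minor zero M))) _))
  where
  laterColumns : ∀ m (M : Mat (suc m)) (j : Fin m) →
    sign (toℕ (suc j)) ·ᵖ ((1ℤ ·ᵖ M zero (suc j)) *ᵖ det m (minor (suc j) (λ r c → signAt₀ c ·ᵖ M r c)))
    ≈ -1ℤ ·ᵖ (sign (toℕ (suc j)) ·ᵖ (M zero (suc j) *ᵖ det m (minor (suc j) M)))
  laterColumns (suc m) M j = ≈-trans
    (·ᵖ-congʳ (sign (toℕ (suc j))) (*ᵖ-cong (·ᵖ-identity (M zero (suc j))) (≈-trans
      (det-cong-≡ (suc m) λ r c → cong (_·ᵖ M (suc r) (punchIn (suc j) c)) (signAt₀-punchIn j c))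
      (det-negateColumn₀ m (minor (suc j) M)))))
    (·ᵖ-*ᵖ-negate (sign (toℕ (suc j))) (M zero (suc j)) _)

det-negateRow₀ : ∀ m (M : Mat (suc m)) → det (suc m) (λ r c → signAt₀ r ·ᵖ M r c) ≈ -1ℤ ·ᵖ det (suc m) M
det-negateRow₀ m M = sumFin-negate (suc m) λ j →
  term-negateEntry (sign (toℕ j)) (M zero j) (det-cong m λ r c → ·ᵖ-identity (M (suc r) (punchIn j c)))

det-conj-signAt₀ : ∀ m (M : Mat (suc m)) → det (suc m) (λ r c → signAt₀ r ·ᵖ (signAt₀ c ·ᵖ M r c)) ≈ det (suc m) M
det-conj-signAt₀ m M = ≈-trans (det-negateRow₀ m (λ r c → signAt₀ c ·ᵖ M r c))
  (≈-trans (·ᵖ-congʳ -1ℤ (det-negateColumn₀ m M)) (-1·ᵖ-involutive _))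

uI : Mat m
uI i j with i ≟ j
... | yes _ = var
... | no  _ = []

charMatrix : (Fin m → Fin m → ℤ) → Mat m
charMatrix A i j = uI i j +ᵖ -ᵖ const (A i j)

-- The diagonal matrix inside charPoly is local to its definition; unification names it here.
charPolyMatrix : ∀ m (A : Fin m → Fin m → ℤ) → Σ (Mat m) λ D → charPoly m A ≡ det m D
charPolyMatrix m A = _ , refl

charPoly≈det-charMatrix : ∀ m (A : Fin m → Fin m → ℤ) → charPoly m A ≈ det m (charMatrix A)
charPoly≈det-charMatrix m A = ≈-trans (≈-reflexive (proj₂ (charPolyMatrix m A))) (det-cong-≡ m entry)
  where
  entry : ∀ i j → proj₁ (charPolyMatrix m A) i j ≡ charMatrix A i j
  entry i j with i ≟ j
  ... | yes _ = refl
  ... | no  _ = refl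

charPoly-cong : ∀ m {A B : Fin m → Fin m → ℤ} → (∀ i j → A i j ≡ B i j) → charPoly m A ≈ charPoly m B
charPoly-cong m {A} {B} e = ≈-trans (charPoly≈det-charMatrix m A)
  (≈-trans (det-cong-≡ m λ i j → cong (λ a → uI i j +ᵖ -ᵖ const a) (e i j))
           (≈-sym (charPoly≈det-charMatrix m B)))

uI-injective : ∀ (π : Fin m → Fin m) → (∀ {i j} → π i ≡ π j → i ≡ j) → ∀ i j → uI (π i) (π j) ≡ uI i j
uI-injective π π-injective i j with π i ≟ π j | i ≟ j
... | yes _  | yes _    = refl
... | yes e  | no  i≢j  = ⊥-elim (i≢j (π-injective e))
... | no  ≢  | yes refl = ⊥-elim (≢ refl)
... | no  _  | no  _    = refl

charMatrix-signAt₀ : ∀ (i j : Fin m) a →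
  uI i j +ᵖ -ᵖ const (signAt₀ i * (signAt₀ j * a)) ≈ signAt₀ i ·ᵖ (signAt₀ j ·ᵖ (uI i j +ᵖ -ᵖ const a))
charMatrix-signAt₀ i j a with i ≟ j
... | yes refl = ≈-trans
  (≈-reflexive (cong (λ b → var +ᵖ -ᵖ const b) (trans (sym (ℤ.*-assoc s s a))
                                                   (trans (cong (_* a) (signAt₀-squared i)) (ℤ.*-identityˡ a)))))
  (≈-sym (≈-trans (·ᵖ-assoc s s d) (≈-trans (≈-reflexive (cong (_·ᵖ d) (signAt₀-squared i))) (·ᵖ-identity d))))
  where
  s : ℤ
  s = signAt₀ i
  d : Poly
  d = var +ᵖ -ᵖ const a
... | no _ = ∷-cong (rearrange (signAt₀ i) (signAt₀ j) a) ≈-refl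
  where
  rearrange : ∀ x y z → -1ℤ * (x * (y * z)) ≡ x * (y * (-1ℤ * z))
  rearrange = solve-∀

charPoly-conj : ∀ m (q : Fin (suc m)) (A B : Fin (suc m) → Fin (suc m) → ℤ) →
  (∀ i j → B (moveZeroTo q i) (moveZeroTo q j) ≡ signAt₀ i * (signAt₀ j * A i j)) →
  charPoly (suc m) B ≈ charPoly (suc m) A
charPoly-conj m q A B B≡SAS = begin
  charPoly (suc m) B                                                  ≈⟨ charPoly≈det-charMatrix (suc m) B ⟩
  det (suc m) (charMatrix B)                                          ≈⟨ det-conj-moveZeroTo q (charMatrix B) ⟨
  det (suc m) (λ i j → charMatrix B (moveZeroTo q i) (moveZeroTo q j)) ≈⟨ det-cong (suc m) entry ⟩
  det (suc m) (λ i j → signAt₀ i ·ᵖ (signAt₀ j ·ᵖ charMatrix A i j))   ≈⟨ det-conj-signAt₀ m (charMatrix A) ⟩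
  det (suc m) (charMatrix A)                                          ≈⟨ charPoly≈det-charMatrix (suc m) A ⟨
  charPoly (suc m) A                                                  ∎
  where
  open ≈-Reasoning
  entry : ∀ i j → charMatrix B (moveZeroTo q i) (moveZeroTo q j) ≈ signAt₀ i ·ᵖ (signAt₀ j ·ᵖ charMatrix A i j)
  entry i j = ≈-trans
    (≈-reflexive (cong₂ (λ d b → d +ᵖ -ᵖ const b) (uI-injective (moveZeroTo q) (moveZeroTo-injective q) i j) (B≡SAS i j)))
    (charMatrix-signAt₀ i j (A i j))

module _ {A : Set} where

  ⊆-snoc⁻ : ∀ {xs : List A} ys y → xs ⊆ ys ++ [ y ] →
    xs ⊆ ys ⊎ ∃ λ xs′ → xs ≡ xs′ ++ [ y ] × xs′ ⊆ ys
  ⊆-snoc⁻ []       y (.y ∷ʳ [])  = inj₁ []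
  ⊆-snoc⁻ []       y (refl ∷ []) = inj₂ ([] , refl , [])
  ⊆-snoc⁻ (z ∷ ys) y (.z ∷ʳ τ) with ⊆-snoc⁻ ys y τ
  ... | inj₁ σ                = inj₁ (z ∷ʳ σ)
  ... | inj₂ (xs′ , refl , σ) = inj₂ (xs′ , refl , z ∷ʳ σ)
  ⊆-snoc⁻ (z ∷ ys) y (_∷_ {x = v} e τ) with ⊆-snoc⁻ ys y τ
  ... | inj₁ σ                = inj₁ (e ∷ σ)
  ... | inj₂ (xs′ , refl , σ) = inj₂ (v ∷ xs′ , refl , e ∷ σ)

  filter-comm : ∀ {P Q : Pred A 0ℓ} (P? : Decidable P) (Q? : Decidable Q) xs →
    filter P? (filter Q? xs) ≡ filter Q? (filter P? xs)
  filter-comm P? Q? []       = refl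
  filter-comm {P} {Q} P? Q? (x ∷ xs) = commute (P? x) (Q? x)
    where
    ih : filter P? (filter Q? xs) ≡ filter Q? (filter P? xs)
    ih = filter-comm P? Q? xs
    commute : Dec (P x) → Dec (Q x) → filter P? (filter Q? (x ∷ xs)) ≡ filter Q? (filter P? (x ∷ xs))
    commute (yes Px) (yes Qx) = begin
      filter P? (filter Q? (x ∷ xs))  ≡⟨ cong (filter P?) (filter-accept Q? Qx) ⟩
      filter P? (x ∷ filter Q? xs)    ≡⟨ filter-accept P? Px ⟩
      x ∷ filter P? (filter Q? xs)    ≡⟨ cong (x ∷_) ih ⟩
      x ∷ filter Q? (filter P? xs)    ≡⟨ filter-accept Q? Qx ⟨
      filter Q? (x ∷ filter P? xs)    ≡⟨ cong (filter Q?) (filter-accept P? Px) ⟨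
      filter Q? (filter P? (x ∷ xs))  ∎
      where open ≡-Reasoning
    commute (yes Px) (no ¬Qx) = trans (cong (filter P?) (filter-reject Q? ¬Qx))
      (trans ih (sym (trans (cong (filter Q?) (filter-accept P? Px)) (filter-reject Q? ¬Qx))))
    commute (no ¬Px) (yes Qx) = trans (cong (filter P?) (filter-accept Q? Qx))
      (trans (filter-reject P? ¬Px) (trans ih (sym (cong (filter Q?) (filter-reject P? ¬Px)))))
    commute (no ¬Px) (no ¬Qx) = trans (cong (filter P?) (filter-reject Q? ¬Qx))
      (trans ih (sym (cong (filter Q?) (filter-reject P? ¬Px))))

  Unique-++-disjoint : ∀ {v : A} xs {ys} → Unique (xs ++ ys) → v ∈ xs → v ∉ ys
  Unique-++-disjoint (x ∷ xs) (x≢ ∷ _) (here refl) v∈ys = All.lookup x≢ (∈-++⁺ʳ xs v∈ys) refl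
  Unique-++-disjoint (x ∷ xs) (_ ∷ u)  (there v∈xs) = Unique-++-disjoint xs u v∈xs

  Unique-++⁻ʳ : ∀ (xs : List A) {ys} → Unique (xs ++ ys) → Unique ys
  Unique-++⁻ʳ []       u       = u
  Unique-++⁻ʳ (x ∷ xs) (_ ∷ u) = Unique-++⁻ʳ xs u

  lookup-++-≥ : ∀ (xs ys : List A) (j : Fin (length (xs ++ ys))) → length xs ≤ toℕ j → lookup (xs ++ ys) j ∈ ys
  lookup-++-≥ []       ys j       _         = ∈-lookup j
  lookup-++-≥ (x ∷ xs) ys (suc j) (s≤s xs≤j) = lookup-++-≥ xs ys j xs≤j

  pair⊆-++-∷ : ∀ {b x : A} xs ys → (b ∷ x ∷ []) ⊆ xs ++ x ∷ ys → x ∉ ys → b ≢ x → b ∈ xs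
  pair⊆-++-∷ []       ys (_ ∷ʳ τ)    x∉ys b≢x = ⊥-elim (x∉ys (to∈ (∷ˡ⁻ τ)))
  pair⊆-++-∷ []       ys (refl ∷ τ)  x∉ys b≢x = ⊥-elim (b≢x refl)
  pair⊆-++-∷ (_ ∷ xs) ys (_ ∷ʳ τ)    x∉ys b≢x = there (pair⊆-++-∷ xs ys τ x∉ys b≢x)
  pair⊆-++-∷ (_ ∷ xs) ys (refl ∷ τ)  x∉ys b≢x = here refl

  drop-take-suc : ∀ k (w : List A) → k < length w →
    ∃₂ λ y ys → drop k w ≡ y ∷ ys × drop (suc k) w ≡ ys × take (suc k) w ≡ take k w ++ [ y ]
  drop-take-suc zero    (y ∷ ys) _           = y , ys , refl , refl , refl
  drop-take-suc (suc k) (z ∷ w)  (s≤s k<len) with drop-take-suc k w k<len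
  ... | y , ys , e₁ , e₂ , e₃ = y , ys , e₁ , e₂ , cong (z ∷_) e₃

  boundary : ∀ (xs ys : List A) → Fin (suc (length (xs ++ ys)))
  boundary []       ys = zero
  boundary (x ∷ xs) ys = suc (boundary xs ys)

  punchIn-boundary : ∀ xs ys (j : Fin (length (xs ++ ys))) → toℕ j < length xs →
    punchIn (boundary xs ys) j Fin.< boundary xs ys
  punchIn-boundary (x ∷ xs) ys zero    _          = s≤s z≤n
  punchIn-boundary (x ∷ xs) ys (suc j) (s≤s j<xs) = s≤s (punchIn-boundary xs ys j j<xs)

  lookup-insert : ∀ xs (v : A) ys .(e : suc (length (xs ++ ys)) ≡ length (xs ++ v ∷ ys)) i →
    lookup (xs ++ v ∷ ys) (cast e (moveZeroTo (boundary xs ys) i)) ≡ lookup (v ∷ xs ++ ys) i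
  lookup-insert []       v ys e zero          = refl
  lookup-insert []       v ys e (suc i)       = cong (lookup ys) (Fin.cast-is-id _ i)
  lookup-insert (x ∷ xs) v ys e zero          = lookup-insert xs v ys (ℕ.suc-injective e) zero
  lookup-insert (x ∷ xs) v ys e (suc zero)    = refl
  lookup-insert (x ∷ xs) v ys e (suc (suc i)) = lookup-insert xs v ys (ℕ.suc-injective e) (suc i)

module _ {n : ℕ} where
  open DecSublist {A = Fin n} _≟_ using (_⊆?_)

  private variable
    a b x : Fin n
    w r : List (Fin n)

  occurrences-here : ∀ (c : Fin n) l → occurrences c (c ∷ l) ≡ suc (occurrences c l)
  occurrences-here c l with c ≟ c
  ... | yes _  = refl
  ... | no c≢c = ⊥-elim (c≢c refl)

  occurrences-there : ∀ {z c : Fin n} l → z ≢ c → occurrences c (z ∷ l) ≡ occurrences c l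
  occurrences-there {z} {c} l z≢c with z ≟ c
  ... | yes z≡c = ⊥-elim (z≢c z≡c)
  ... | no  _   = refl

  occurrences-++ : ∀ (c : Fin n) xs ys → occurrences c (xs ++ ys) ≡ occurrences c xs ℕ.+ occurrences c ys
  occurrences-++ c xs ys = trans (cong length (filter-++ (_≟ c) xs ys)) (length-++ (filter (_≟ c) xs))

  ∈⇒occurrences≢0 : ∀ {c : Fin n} {l} → c ∈ l → occurrences c l ≢ 0
  ∈⇒occurrences≢0 c∈l = nonempty (∈-filter⁺ (_≟ _) c∈l refl)
    where
    nonempty : ∀ {v : Fin n} {xs} → v ∈ xs → length xs ≢ 0
    nonempty (here _)  ()
    nonempty (there _) ()

  occurrences≢0⇒∈ : ∀ {c : Fin n} l → occurrences c l ≢ 0 → c ∈ l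
  occurrences≢0⇒∈     []      ≢0 = ⊥-elim (≢0 refl)
  occurrences≢0⇒∈ {c} (z ∷ l) ≢0 = headOrTail (z ≟ c)
    where
    headOrTail : Dec (z ≡ c) → c ∈ z ∷ l
    headOrTail (yes refl) = here refl
    headOrTail (no z≢c)   = there (occurrences≢0⇒∈ l (≢0 ∘ trans (occurrences-there l z≢c)))

  filter-≢-chordOrder-snoc : ∀ l (z : Fin n) →
    filter (¬? ∘ (z ≟_)) (chordOrder (l ++ [ z ])) ≡ filter (¬? ∘ (z ≟_)) (chordOrder l)
  filter-≢-chordOrder-snoc []      z = filter-reject (¬? ∘ (z ≟_)) (λ z≢z → z≢z refl)
  filter-≢-chordOrder-snoc (y ∷ l) z = step (z ≟ y)
    where
    z≢? : Decidable (z ≢_)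
    z≢? = ¬? ∘ (z ≟_)
    ih : filter z≢? (chordOrder (l ++ [ z ])) ≡ filter z≢? (chordOrder l)
    ih = filter-≢-chordOrder-snoc l z
    step : Dec (z ≡ y) →
      filter z≢? (y ∷ filter (¬? ∘ (y ≟_)) (chordOrder (l ++ [ z ]))) ≡ filter z≢? (y ∷ filter (¬? ∘ (y ≟_)) (chordOrder l))
    step (yes refl) = trans (filter-reject z≢? (λ z≢z → z≢z refl))
      (trans (cong (filter z≢?) ih) (sym (filter-reject z≢? (λ z≢z → z≢z refl))))
    step (no z≢y) = trans (filter-accept z≢? z≢y) (trans (cong (y ∷_) (begin
      filter z≢? (filter (¬? ∘ (y ≟_)) (chordOrder (l ++ [ z ])))  ≡⟨ filter-comm z≢? (¬? ∘ (y ≟_)) (chordOrder (l ++ [ z ])) ⟩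
      filter (¬? ∘ (y ≟_)) (filter z≢? (chordOrder (l ++ [ z ])))  ≡⟨ cong (filter (¬? ∘ (y ≟_))) ih ⟩
      filter (¬? ∘ (y ≟_)) (filter z≢? (chordOrder l))             ≡⟨ filter-comm z≢? (¬? ∘ (y ≟_)) (chordOrder l) ⟨
      filter z≢? (filter (¬? ∘ (y ≟_)) (chordOrder l))             ∎))
      (sym (filter-accept z≢? z≢y)))
      where open ≡-Reasoning

  chordOrder-snoc : x ∈ r → chordOrder (r ++ [ x ]) ≡ chordOrder r
  chordOrder-snoc {r = z ∷ r} (here refl)  = cong (z ∷_) (filter-≢-chordOrder-snoc r z)
  chordOrder-snoc {r = z ∷ r} (there x∈r) = cong (λ l → z ∷ filter (¬? ∘ (z ≟_)) l) (chordOrder-snoc x∈r)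

  filter-≢-remove : ∀ (x : Fin n) xs ys → x ∉ xs → x ∉ ys → filter (¬? ∘ (x ≟_)) (xs ++ x ∷ ys) ≡ xs ++ ys
  filter-≢-remove x xs ys x∉xs x∉ys = begin
    filter (¬? ∘ (x ≟_)) (xs ++ x ∷ ys)                        ≡⟨ filter-++ (¬? ∘ (x ≟_)) xs (x ∷ ys) ⟩
    filter (¬? ∘ (x ≟_)) xs ++ filter (¬? ∘ (x ≟_)) (x ∷ ys)  ≡⟨ cong₂ _++_ (keep x∉xs)
                                                                   (trans (filter-reject (¬? ∘ (x ≟_)) (λ x≢x → x≢x refl)) (keep x∉ys)) ⟩
    xs ++ ys                                                   ∎
    where
    open ≡-Reasoning
    keep : ∀ {l} → x ∉ l → filter (¬? ∘ (x ≟_)) l ≡ l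
    keep {l} x∉l = filter-all (¬? ∘ (x ≟_)) (¬Any⇒All¬ l x∉l)

  pair⊆-chordOrder : ∀ r → (b ∷ x ∷ []) ⊆ r → occurrences x r ≡ 1 → b ≢ x → (b ∷ x ∷ []) ⊆ chordOrder r
  pair⊆-chordOrder {b} {x} (z ∷ r) (refl ∷ τ) once b≢x =
    refl ∷ from∈ (∈-filter⁺ (¬? ∘ (b ≟_)) (∈-deduplicate⁺ _≟_ (to∈ τ)) b≢x)
  pair⊆-chordOrder {b} {x} (z ∷ r) (.z ∷ʳ τ) once b≢x = skip (z ≟ x) (z ≟ b)
    where
    x∈r : x ∈ r
    x∈r = to∈ (∷ˡ⁻ τ)
    skip : Dec (z ≡ x) → Dec (z ≡ b) → (b ∷ x ∷ []) ⊆ chordOrder (z ∷ r)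
    skip (yes refl) _          = ⊥-elim (∈⇒occurrences≢0 x∈r (ℕ.suc-injective (trans (sym (occurrences-here z r)) once)))
    skip (no z≢x)   (yes refl) = refl ∷ from∈ (∈-filter⁺ (¬? ∘ (b ≟_)) (∈-deduplicate⁺ _≟_ x∈r) b≢x)
    skip (no z≢x)   (no z≢b)   = z ∷ʳ subst (_⊆ _) (filter-all (¬? ∘ (z ≟_)) (z≢b ∷ z≢x ∷ []))
      (filter⁺ (¬? ∘ (z ≟_)) (¬? ∘ (z ≟_)) (λ { refl P → P })
               (pair⊆-chordOrder r τ (trans (sym (occurrences-there r z≢x)) once) b≢x))

  Alternate-sym : Alternate w a b → Alternate w b a
  Alternate-sym (inj₁ τ) = inj₂ τ
  Alternate-sym (inj₂ τ) = inj₁ τ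

  pattern-rotateˡ : (a ∷ b ∷ a ∷ b ∷ []) ⊆ x ∷ r → Alternate (r ++ [ x ]) a b
  pattern-rotateˡ {x = x} (.x ∷ʳ τ) = inj₁ (++⁺ʳ [ x ] τ)
  pattern-rotateˡ         (refl ∷ τ) = inj₂ (++⁺ τ (refl ∷ []))

  pattern-rotateʳ : (a ∷ b ∷ a ∷ b ∷ []) ⊆ r ++ [ x ] → Alternate (x ∷ r) a b
  pattern-rotateʳ {a} {b} {r} {x} τ with ⊆-snoc⁻ r x τ
  ... | inj₁ σ            = inj₁ (x ∷ʳ σ)
  ... | inj₂ (xs′ , e , σ) with ∷ʳ-injective (a ∷ b ∷ a ∷ []) xs′ e
  ...   | refl , refl = inj₂ (refl ∷ σ)

  Alternate-rotateˡ : Alternate (x ∷ r) a b → Alternate (r ++ [ x ]) a b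
  Alternate-rotateˡ (inj₁ τ) = pattern-rotateˡ τ
  Alternate-rotateˡ (inj₂ τ) = Alternate-sym (pattern-rotateˡ τ)

  Alternate-rotateʳ : Alternate (r ++ [ x ]) a b → Alternate (x ∷ r) a b
  Alternate-rotateʳ (inj₁ τ) = pattern-rotateʳ τ
  Alternate-rotateʳ (inj₂ τ) = Alternate-sym (pattern-rotateʳ τ)

  Alternate-head⇒pair⊆ : Alternate (x ∷ r) x b → b ≢ x → (b ∷ x ∷ []) ⊆ r
  Alternate-head⇒pair⊆ (inj₁ (_ ∷ʳ σ)) b≢x = ⊆-trans (take-⊆ 2 _) (∷ˡ⁻ σ)
  Alternate-head⇒pair⊆ (inj₁ (refl ∷ σ)) b≢x = ⊆-trans (take-⊆ 2 _) σ
  Alternate-head⇒pair⊆ (inj₂ (_ ∷ʳ σ)) b≢x = ⊆-trans (take-⊆ 2 _) σ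
  Alternate-head⇒pair⊆ (inj₂ (b≡x ∷ σ)) b≢x = ⊥-elim (b≢x b≡x)

  alternate? : ∀ w a b → Dec (Alternate w a b)
  alternate? w a b = ((a ∷ b ∷ a ∷ b ∷ []) ⊆? w) ⊎-dec ((b ∷ a ∷ b ∷ a ∷ []) ⊆? w)

-- Oriented intersection matrices

orientation : Fin m → Fin m → ℤ
orientation i j with i <? j | j <? i
... | yes _ | _     = 1ℤ
... | no  _ | yes _ = -1ℤ
... | no  _ | no  _ = 0ℤ

orientation-< : ∀ {i j : Fin m} → i Fin.< j → orientation i j ≡ 1ℤ
orientation-< {i = i} {j} i<j with i <? j
... | yes _   = refl
... | no  i≮j = ⊥-elim (i≮j i<j)

orientation-> : ∀ {i j : Fin m} → j Fin.< i → orientation i j ≡ -1ℤ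
orientation-> {i = i} {j} j<i with i <? j | j <? i
... | yes i<j | _       = ⊥-elim (Fin.<-asym i<j j<i)
... | no  _   | yes _   = refl
... | no  _   | no  j≮i = ⊥-elim (j≮i j<i)

orientation-refl : (i : Fin m) → orientation i i ≡ 0ℤ
orientation-refl i with i <? i
... | yes i<i = ⊥-elim (Fin.<-irrefl refl i<i)
... | no  _   = refl

punchIn-mono-< : ∀ (q : Fin (suc m)) {i j} → i Fin.< j → punchIn q i Fin.< punchIn q j
punchIn-mono-< zero    i<j = s≤s i<j
punchIn-mono-< (suc q) {zero}  {suc j} i<j       = s≤s z≤n
punchIn-mono-< (suc q) {suc i} {suc j} (s≤s i<j) = s≤s (punchIn-mono-< q i<j)

orientation-punchIn : ∀ (q : Fin (suc m)) i j → orientation (punchIn q i) (punchIn q j) ≡ orientation i j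
orientation-punchIn q i j with Fin.<-cmp i j
... | tri< i<j _ _ = trans (orientation-< (punchIn-mono-< q i<j)) (sym (orientation-< i<j))
... | tri≈ _ refl _ = trans (orientation-refl (punchIn q i)) (sym (orientation-refl i))
... | tri> _ _ j<i = trans (orientation-> (punchIn-mono-< q j<i)) (sym (orientation-> j<i))

crossingEntry : ∀ {P : Set} → Dec P → Fin m → Fin m → ℤ
crossingEntry (yes _) i j = orientation i j
crossingEntry (no  _) i j = 0ℤ

crossingEntry-yes : ∀ {P : Set} (d : Dec P) (i j : Fin m) → P → crossingEntry d i j ≡ orientation i j
crossingEntry-yes (yes _) i j _ = refl
crossingEntry-yes (no ¬P) i j P = ⊥-elim (¬P P)

crossingEntry-no : ∀ {P : Set} (d : Dec P) (i j : Fin m) → ¬ P → crossingEntry d i j ≡ 0ℤ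
crossingEntry-no (yes P) i j ¬P = ⊥-elim (¬P P)
crossingEntry-no (no _)  i j _  = refl

module _ {n : ℕ} where

  -- crossingMatrix w c is the adjacency matrix of the oriented intersection graph of the
  -- cut word w, with chord c i as vertex i
  crossingMatrix : List (Fin n) → (Fin m → Fin n) → Fin m → Fin m → ℤ
  crossingMatrix w c i j = crossingEntry (alternate? w (c i) (c j)) i j

  adjMatrix≡crossingMatrix : ∀ w i j → adjMatrix w i j ≡ crossingMatrix w (lookup (chordOrder w)) i j
  adjMatrix≡crossingMatrix w i j with alternate? w (lookup (chordOrder w) i) (lookup (chordOrder w) j)
  ... | no  _ = refl
  ... | yes _ with i <? j | j <? i
  ...   | yes _ | _     = refl
  ...   | no  _ | yes _ = refl
  ...   | no  _ | no  _ = refl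

  orientedCharPoly-relabel : ∀ (w : List (Fin n)) {L k} (c : Fin k → Fin n) →
    chordOrder w ≡ L → (e : length L ≡ k) → (∀ i → lookup L (cast (sym e) i) ≡ c i) →
    orientedCharPoly w ≈ charPoly k (crossingMatrix w c)
  orientedCharPoly-relabel w c refl refl relabel = charPoly-cong _ λ i j →
    trans (adjMatrix≡crossingMatrix w i j)
          (cong₂ (λ a b → crossingEntry (alternate? w a b) i j) (labels i) (labels j))
    where
    labels : ∀ i → lookup (chordOrder w) i ≡ c i
    labels i = trans (cong (lookup (chordOrder w)) (sym (Fin.cast-is-id refl i))) (relabel i)

-- The cut moves past the first endpoint of chord x in the word x ∷ r,
-- whose other endpoint lies in r.
module MoveCut {n : ℕ} (x : Fin n) (r : List (Fin n)) (once : occurrences x r ≡ 1) where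

  x∈r : x ∈ r
  x∈r = occurrences≢0⇒∈ r (λ none → ℕ.1+n≢0 (trans (sym once) none))

  split : ∃₂ λ D₁ D₂ → chordOrder r ≡ D₁ ++ [ x ] ++ D₂
  split = ∈-∃++ (∈-deduplicate⁺ _≟_ x∈r)

  D₁ D₂ : List (Fin n)
  D₁ = proj₁ split
  D₂ = proj₁ (proj₂ split)

  chordOrder-r : chordOrder r ≡ D₁ ++ x ∷ D₂
  chordOrder-r = proj₂ (proj₂ split)

  unique : Unique (D₁ ++ x ∷ D₂)
  unique = subst Unique chordOrder-r (deduplicate-! _≟_ r)

  x∉D₁ : x ∉ D₁
  x∉D₁ x∈D₁ = Unique-++-disjoint D₁ unique x∈D₁ (here refl)

  x∉D₂ : x ∉ D₂
  x∉D₂ = Unique[x∷xs]⇒x∉xs (Unique-++⁻ʳ D₁ unique)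

  chordOrder-before : chordOrder (x ∷ r) ≡ x ∷ D₁ ++ D₂
  chordOrder-before = cong (x ∷_)
    (trans (cong (filter (¬? ∘ (x ≟_))) chordOrder-r) (filter-≢-remove x D₁ D₂ x∉D₁ x∉D₂))

  chordOrder-after : chordOrder (r ++ [ x ]) ≡ D₁ ++ x ∷ D₂
  chordOrder-after = trans (chordOrder-snoc x∈r) chordOrder-r

  others : ℕ
  others = length (D₁ ++ D₂)

  xIndex : Fin (suc others)
  xIndex = boundary D₁ D₂

  length-after : length (D₁ ++ x ∷ D₂) ≡ suc others
  length-after = length-++-sucʳ D₁ x D₂

  labels labels′ : Fin (suc others) → Fin n
  labels = lookup (x ∷ D₁ ++ D₂)
  labels′ i = lookup (D₁ ++ x ∷ D₂) (cast (sym length-after) i)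

  labels′-moveZeroTo : ∀ i → labels′ (moveZeroTo xIndex i) ≡ labels i
  labels′-moveZeroTo = lookup-insert D₁ x D₂ (sym length-after)

  -- A chord crossing x has an endpoint between the two endpoints of x, so its first
  -- endpoint precedes the second one of x: it comes before x in chordOrder (r ++ [ x ]).
  crossing⇒before : ∀ j → Alternate (x ∷ r) x (lookup (D₁ ++ D₂) j) → punchIn xIndex j Fin.< xIndex
  crossing⇒before j alt = punchIn-boundary D₁ D₂ j j<D₁
    where
    b : Fin n
    b = lookup (D₁ ++ D₂) j

    b≢x : b ≢ x
    b≢x b≡x with ∈-++⁻ D₁ (∈-lookup {xs = D₁ ++ D₂} j)
    ... | inj₁ b∈D₁ = x∉D₁ (subst (_∈ D₁) b≡x b∈D₁)
    ... | inj₂ b∈D₂ = x∉D₂ (subst (_∈ D₂) b≡x b∈D₂)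

    b∈D₁ : b ∈ D₁
    b∈D₁ = pair⊆-++-∷ D₁ D₂
      (subst ((b ∷ x ∷ []) ⊆_) chordOrder-r (pair⊆-chordOrder r (Alternate-head⇒pair⊆ alt b≢x) once b≢x))
      x∉D₂ b≢x

    j<D₁ : toℕ j < length D₁
    j<D₁ with toℕ j ℕ.<? length D₁
    ... | yes j< = j<
    ... | no  j≮ = ⊥-elim (Unique-++-disjoint D₁ unique b∈D₁ (there (lookup-++-≥ D₁ D₂ j (ℕ.≮⇒≥ j≮))))

  orientation-moveZeroTo : ∀ i j → Alternate (x ∷ r) (labels i) (labels j) →
    orientation (moveZeroTo xIndex i) (moveZeroTo xIndex j) ≡ signAt₀ i * (signAt₀ j * orientation i j)
  orientation-moveZeroTo zero    zero    _   = orientation-refl xIndex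
  orientation-moveZeroTo zero    (suc j) alt = orientation-> (crossing⇒before j alt)
  orientation-moveZeroTo (suc i) zero    alt = orientation-< (crossing⇒before i (Alternate-sym alt))
  orientation-moveZeroTo (suc i) (suc j) _   = trans (orientation-punchIn xIndex i j)
    (sym (trans (ℤ.*-identityˡ _) (trans (ℤ.*-identityˡ _) (orientation-punchIn zero i j))))

  crossingMatrix-moveZeroTo : ∀ i j →
    crossingMatrix (r ++ [ x ]) labels′ (moveZeroTo xIndex i) (moveZeroTo xIndex j) ≡
    signAt₀ i * (signAt₀ j * crossingMatrix (x ∷ r) labels i j)
  crossingMatrix-moveZeroTo i j with alternate? (x ∷ r) (labels i) (labels j)
  ... | yes alt = trans (crossingEntry-yes (alternate? (r ++ [ x ]) _ _) _ _ alt′) (orientation-moveZeroTo i j alt)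
    where
    alt′ : Alternate (r ++ [ x ]) (labels′ (moveZeroTo xIndex i)) (labels′ (moveZeroTo xIndex j))
    alt′ = subst₂ (Alternate (r ++ [ x ])) (sym (labels′-moveZeroTo i)) (sym (labels′-moveZeroTo j))
                  (Alternate-rotateˡ alt)
  ... | no ¬alt = trans (crossingEntry-no (alternate? (r ++ [ x ]) _ _) _ _
                          (¬alt ∘ Alternate-rotateʳ ∘ subst₂ (Alternate (r ++ [ x ])) (labels′-moveZeroTo i) (labels′-moveZeroTo j)))
                        (sym (trans (cong (signAt₀ i *_) (ℤ.*-zeroʳ (signAt₀ j))) (ℤ.*-zeroʳ (signAt₀ i))))

  orientedCharPoly-moveCut : orientedCharPoly (r ++ [ x ]) ≈ orientedCharPoly (x ∷ r)
  orientedCharPoly-moveCut = begin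
    orientedCharPoly (r ++ [ x ])
      ≈⟨ orientedCharPoly-relabel (r ++ [ x ]) labels′ chordOrder-after length-after (λ _ → refl) ⟩
    charPoly (suc others) (crossingMatrix (r ++ [ x ]) labels′)
      ≈⟨ charPoly-conj others xIndex (crossingMatrix (x ∷ r) labels) (crossingMatrix (r ++ [ x ]) labels′)
                       crossingMatrix-moveZeroTo ⟩
    charPoly (suc others) (crossingMatrix (x ∷ r) labels)
      ≈⟨ orientedCharPoly-relabel (x ∷ r) labels chordOrder-before refl (λ i → cong labels (Fin.cast-is-id refl i)) ⟨
    orientedCharPoly (x ∷ r)
      ∎
    where open ≈-Reasoning

module _ {n : ℕ} where

  rotate-suc : ∀ k (w : List (Fin n)) → k < length w →
    ∃₂ λ y rest → rotate k w ≡ y ∷ rest × rotate (suc k) w ≡ rest ++ [ y ]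
  rotate-suc k w k<len with drop-take-suc k w k<len
  ... | y , ys , drop-k , drop-suc-k , take-suc-k =
    y , ys ++ take k w , cong (_++ take k w) drop-k ,
    trans (cong₂ _++_ drop-suc-k take-suc-k) (sym (++-assoc ys (take k w) [ y ]))

  IsChordWord-rotate : ∀ k {w} → IsChordWord n w → IsChordWord n (rotate k w)
  IsChordWord-rotate k {w} chords c = begin
    occurrences c (drop k w ++ take k w)              ≡⟨ occurrences-++ c (drop k w) (take k w) ⟩
    occurrences c (drop k w) ℕ.+ occurrences c (take k w) ≡⟨ ℕ.+-comm (occurrences c (drop k w)) _ ⟩
    occurrences c (take k w) ℕ.+ occurrences c (drop k w) ≡⟨ occurrences-++ c (take k w) (drop k w) ⟨
    occurrences c (take k w ++ drop k w)              ≡⟨ cong (occurrences c) (take++drop≡id k w) ⟩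
    occurrences c w                                   ≡⟨ chords c ⟩
    2                                                 ∎
    where open ≡-Reasoning

  orientedCharPoly-rotate-suc : ∀ k w → IsChordWord n w → k < length w →
    orientedCharPoly (rotate (suc k) w) ≈ orientedCharPoly (rotate k w)
  orientedCharPoly-rotate-suc k w chords k<len with rotate-suc k w k<len
  ... | y , rest , rotate-k , rotate-suc-k =
    subst₂ (λ u v → orientedCharPoly u ≈ orientedCharPoly v) (sym rotate-suc-k) (sym rotate-k)
           (MoveCut.orientedCharPoly-moveCut y rest once)
    where
    once : occurrences y rest ≡ 1
    once = ℕ.suc-injective (trans (sym (occurrences-here y rest))
      (trans (cong (occurrences y) (sym rotate-k)) (IsChordWord-rotate k chords y)))

  orientedCharPoly-rotate : ∀ k w → IsChordWord n w → k < length w →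
    orientedCharPoly (rotate k w) ≈ orientedCharPoly (rotate 0 w)
  orientedCharPoly-rotate zero    w chords _     = ≈-refl
  orientedCharPoly-rotate (suc k) w chords k<len = ≈-trans (orientedCharPoly-rotate-suc k w chords k<len′)
    (orientedCharPoly-rotate k w chords k<len′)
    where
    k<len′ : k < length w
    k<len′ = ℕ.<-trans (ℕ.n<1+n k) k<len

mainTheorem3 : (n : ℕ) (w : List (Fin n)) → IsChordWord n w →
    (k k′ : ℕ) → k < length w → k′ < length w →
    orientedCharPoly (rotate k w) ≈ᵖ orientedCharPoly (rotate k′ w)
mainTheorem3 n w chords k k′ k<len k′<len = coeffwise
  (≈-trans (orientedCharPoly-rotate k w chords k<len) (≈-sym (orientedCharPoly-rotate k′ w chords k′<len)))
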